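{- Let $A,B\colon\mathsf{Set}\to\mathsf{Set}$ be functors with $A$ $\omega$-continuous and $B$ polynomial, and let $F\colon\mathsf{Set}\to\mathsf{Set}$ be a functor. A map $\alpha_\omega\colon FA_\omega\to B_\omega$ is causal if and only if there exist a functor $G\colon\mathsf{Set}\to\mathsf{Set}$, a natural transformation $\lambda\colon GA\Rightarrow BG$ and a natural transformation $\kappa\colon F\Rightarrow G$ such that $\alpha_\omega=\beta_\omega\circ\kappa_{A_\omega}$, where $\beta_\omega\colon GA_\omega\to B_\omega$ is the unique map induced by $\lambda$, i.e. the unique map with $\zeta_B\circ\beta_\omega=B\beta_\omega\circ\lambda_{A_\omega}\circ G\zeta_A$ for the final coalgebras $(A_\omega,\zeta_A)$ and $(B_\omega,\zeta_B)$.
   Context: Final sequence of $A$: $A_0=1$, $A_{i+1}=AA_i$, $A_j=\lim_{i<j}A_i$ at limit $j$, with connecting maps $A_{j,i}\colon A_j\to A_i$, $A_{i,i}=\mathrm{id}$, $A_{j+1,i+1}=AA_{j,i}$. $\omega$-continuous: preserves limits of $\omega^{op}$-chains; then $A_\omega$ is the carrier of a final $A$-coalgebra $(A_\omega,\zeta_A)$ with $\zeta_A=A_{\omega+1,\omega}^{ -1}$ (similarly for $B$; polynomial functors are $\omega$-continuous). $B$ is polynomial if isomorphic to $X\mapsto\coprod_{a\in I}X^{E_a}$. A map $\alpha\colon FA_\omega\to B_\omega$ is causal if for every set $X$, all $f,g\colon X\to A_\omega$ and $i<\omega$, $A_{\omega,i}\circ f=A_{\omega,i}\circ g$ implies $B_{\omega,i}\circ\alpha\circ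 Ff=B_{\omega,i}\circ\alpha\circ Fg$. -}

module Defs where

open import Level using (0ℓ)
open import Data.Nat using (ℕ; zero; suc)
open import Data.Unit using (⊤; tt)
open import Data.Product using (Σ; _,_; proj₁; proj₂; ∃; _×_)
open import Function using (_∘_; id)
open import Function.Definitions using (Bijective)
open import Relation.Binary.PropositionalEquality
  using (_≡_; refl; sym; trans; cong; _≗_)

-- Endofunctors on Set (pointwise functor laws; F₁ respects pointwise
-- equality of maps, automatic in set theory).

record Functor : Set₁ where
  field
    F₀    : Set → Set
    F₁    : {X Y : Set} → (X → Y) → F₀ X → F₀ Y
    F-id  : {X : Set} → F₁ (id {A = X}) ≗ id
    F-∘   : {X Y Z : Set} (g : Y → Z) (f : X → Y) →
            F₁ (g ∘ f) ≗ F₁ g ∘ F₁ f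
    F-cong : {X Y : Set} {f g : X → Y} → f ≗ g → F₁ f ≗ F₁ g
open Functor public

_⊙_ : Functor → Functor → Functor
G ⊙ A = record
  { F₀ = λ X → F₀ G (F₀ A X)
  ; F₁ = λ f → F₁ G (F₁ A f)
  ; F-id = λ x → trans (F-cong G (F-id A) x) (F-id G x)
  ; F-∘ = λ g f x → trans (F-cong G (F-∘ A g f) x) (F-∘ G (F₁ A g) (F₁ A f) x)
  ; F-cong = λ e → F-cong G (F-cong A e)
  }

record NatTrans (F G : Functor) : Set₁ where
  field
    η   : (X : Set) → F₀ F X → F₀ G X
    nat : {X Y : Set} (f : X → Y) → η Y ∘ F₁ F f ≗ F₁ G f ∘ η X
open NatTrans public

record Chain : Set₁ where
  field
    Obj : ℕ → Set
    map : (i : ℕ) → Obj (suc i) → Obj i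
open Chain public

Lim : Chain → Set
Lim C = Σ ((i : ℕ) → Obj C i) λ x → (i : ℕ) → map C i (x (suc i)) ≡ x i

π : (C : Chain) (i : ℕ) → Lim C → Obj C i
π C i x = proj₁ x i

mapChain : Functor → Chain → Chain
mapChain A C = record { Obj = λ i → F₀ A (Obj C i) ; map = λ i → F₁ A (map C i) }

canonical : (A : Functor) (C : Chain) → F₀ A (Lim C) → Lim (mapChain A C)
canonical A C x =
    (λ i → F₁ A (π C i) x)
  , (λ i → trans (sym (F-∘ A (map C i) (π C (suc i)) x))
                 (F-cong A (λ y → proj₂ y i) x))

ωContinuous : Functor → Set₁
ωContinuous A = (C : Chain) → Bijective _≡_ _≡_ (canonical A C)

record IsPolynomial (B : Functor) : Set₁ where
  field
    I   : Set
    E   : I → Set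
    φ   : (X : Set) → F₀ B X → Σ I (λ a → E a → X)
    φ-bij : (X : Set) → Bijective _≡_ _≡_ (φ X)
    φ-nat : {X Y : Set} (f : X → Y) (x : F₀ B X) →
            φ Y (F₁ B f x) ≡ (proj₁ (φ X x) , f ∘ proj₂ (φ X x))

Seq : Functor → ℕ → Set
Seq A zero    = ⊤
Seq A (suc i) = F₀ A (Seq A i)

conn : (A : Functor) (i : ℕ) → Seq A (suc i) → Seq A i
conn A zero    = λ _ → tt
conn A (suc i) = F₁ A (conn A i)

finalChain : Functor → Chain
finalChain A = record { Obj = Seq A ; map = conn A }

Aω : Functor → Set
Aω A = Lim (finalChain A)

proj : (A : Functor) (i : ℕ) → Aω A → Seq A i
proj A = π (finalChain A)

stepSeq : (A : Functor) → F₀ A (Aω A) → (i : ℕ) → Seq A i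
stepSeq A x zero    = tt
stepSeq A x (suc i) = F₁ A (proj A i) x

stepCoh : (A : Functor) (x : F₀ A (Aω A)) (i : ℕ) →
          conn A i (stepSeq A x (suc i)) ≡ stepSeq A x i
stepCoh A x zero    = refl
stepCoh A x (suc i) =
  trans (sym (F-∘ A (conn A i) (proj A (suc i)) x))
        (F-cong A (λ y → proj₂ y i) x)

step : (A : Functor) → F₀ A (Aω A) → Aω A
step A x = stepSeq A x , stepCoh A x

IsInverseOfStep : (A : Functor) → (Aω A → F₀ A (Aω A)) → Set
IsInverseOfStep A ζ = (∀ x → ζ (step A x) ≡ x) × (∀ y → step A (ζ y) ≡ y)

Causal : (A B F : Functor) → (F₀ F (Aω A) → Aω B) → Set₁
Causal A B F α =
  (X : Set) (f g : X → Aω A) (i : ℕ) →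
  proj A i ∘ f ≗ proj A i ∘ g →
  proj B i ∘ α ∘ F₁ F f ≗ proj B i ∘ α ∘ F₁ F g

module Submission where

-- (⇐) The unique solution β is computed level by level: B_{ω,i} ∘ β factors
--     through G A_{ω,i} (lemma `solution-levels`).  Hence B_{ω,i} ∘ β ∘ κ only
--     depends on A_{ω,i}, which is causality.  The same lemma gives uniqueness.
-- (⇒) Elements of B_ω are trees: ζ_B followed by the polynomial presentation of
--     B gives a root shape and children.  For causal α we build G X as
--     F X ⊎ Position X, where a position records a finite path into the tree of
--     α (only its first m+1 levels matter, by causality) together with the
--     input in F(A^{m+1} X) still to be unfolded.  λ reads off the next shape and
--     moves one level down; β sends a position to the subtree of α at its path.

open import Defs
open import Level using (0ℓ)
open import Data.Product using (Σ; _×_; _,_; proj₁; proj₂)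
open import Data.Sum using (_⊎_; inj₁; inj₂)
open import Data.Unit using (⊤; tt)
open import Data.Nat using (ℕ; zero; suc; _+_)
open import Data.Nat.Properties using (+-identityʳ; +-comm)
open import Function using (_∘_; id)
open import Function.Bundles using (_⇔_; mk⇔)
open import Relation.Binary.PropositionalEquality
  using (_≡_; refl; sym; trans; cong; subst; _≗_; module ≡-Reasoning)
open import Axiom.Extensionality.Propositional using (Extensionality)
open import Axiom.UniquenessOfIdentityProofs.WithK using (uip)

Lim-≡ : Extensionality 0ℓ 0ℓ → {C : Chain} {a b : Lim C} →
        (∀ i → π C i a ≡ π C i b) → a ≡ b
Lim-≡ ext {C} {f , pf} {g , pg} h with ext h
... | refl = cong (f ,_) (ext (λ i → uip (pf i) (pg i)))

module _ {I : Set} (E : I → Set) {Z : Set} where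

  Σ-split : {a a' : I} {f : E a → Z} {g : E a' → Z} →
            _≡_ {A = Σ I (λ a → E a → Z)} (a , f) (a' , g) →
            Σ (a ≡ a') (λ q → ∀ x → f x ≡ g (subst E q x))
  Σ-split refl = refl , λ x → refl

  Σ-ext : Extensionality 0ℓ 0ℓ → {a a' : I} (q : a ≡ a') {f : E a → Z} {g : E a' → Z} →
          (∀ x → f x ≡ g (subst E q x)) → _≡_ {A = Σ I (λ a → E a → Z)} (a , f) (a' , g)
  Σ-ext ext refl h = cong (_ ,_) (ext h)

module Polynomial (B : Functor) (pol : IsPolynomial B) where
  open IsPolynomial pol public

  Ext : Set → Set
  Ext X = Σ I (λ a → E a → X)

  φ⁻¹ : (X : Set) → Ext X → F₀ B X
  φ⁻¹ X r = proj₁ (proj₂ (φ-bij X) r)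

  φ-φ⁻¹ : {X : Set} (r : Ext X) → φ X (φ⁻¹ X r) ≡ r
  φ-φ⁻¹ {X} r = proj₂ (proj₂ (φ-bij X) r) refl

  ≡F₁φ⁻¹ : {X Y : Set} (f : X → Y) (x : F₀ B Y) (r : Ext X) →
           φ Y x ≡ (proj₁ r , f ∘ proj₂ r) → x ≡ F₁ B f (φ⁻¹ X r)
  ≡F₁φ⁻¹ {X} {Y} f x r h = proj₁ (φ-bij Y) (begin
    φ Y x                          ≡⟨ h ⟩
    (proj₁ r , f ∘ proj₂ r)        ≡⟨ cong (λ z → proj₁ z , f ∘ proj₂ z) (φ-φ⁻¹ r) ⟨
    (proj₁ r′ , f ∘ proj₂ r′)      ≡⟨ φ-nat f (φ⁻¹ X r) ⟨
    φ Y (F₁ B f (φ⁻¹ X r))         ∎)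
    where
    open ≡-Reasoning
    r′ = φ X (φ⁻¹ X r)

  φ⁻¹-nat : {X Y : Set} (f : X → Y) (r : Ext X) (r' : Ext Y) →
            r' ≡ (proj₁ r , f ∘ proj₂ r) → φ⁻¹ Y r' ≡ F₁ B f (φ⁻¹ X r)
  φ⁻¹-nat f r r' h = ≡F₁φ⁻¹ f _ r (trans (φ-φ⁻¹ r') h)

IsSolution : (A B G : Functor) → NatTrans (G ⊙ A) (B ⊙ G) →
             (Aω A → F₀ A (Aω A)) → (Aω B → F₀ B (Aω B)) → (F₀ G (Aω A) → Aω B) → Set
IsSolution A B G lam ζA ζB β = ζB ∘ β ≗ F₁ B β ∘ η lam (Aω A) ∘ F₁ G ζA

Factorisation : (A B F : Functor) → (Aω A → F₀ A (Aω A)) → (Aω B → F₀ B (Aω B)) →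
                (F₀ F (Aω A) → Aω B) → Set₁
Factorisation A B F ζA ζB α =
  Σ Functor λ G → Σ (NatTrans (G ⊙ A) (B ⊙ G)) λ lam → Σ (NatTrans F G) λ κ →
  Σ (F₀ G (Aω A) → Aω B) λ β →
    IsSolution A B G lam ζA ζB β
    × ((β′ : F₀ G (Aω A) → Aω B) → IsSolution A B G lam ζA ζB β′ → β′ ≗ β)
    × (α ≗ β ∘ η κ (Aω A))

module Solutions (A B G : Functor) (lam : NatTrans (G ⊙ A) (B ⊙ G))
  (ζA : Aω A → F₀ A (Aω A)) (invA : IsInverseOfStep A ζA)
  (ζB : Aω B → F₀ B (Aω B)) (invB : IsInverseOfStep B ζB) where

  approx : (i : ℕ) → F₀ G (Seq A i) → Seq B i
  approx zero    _ = tt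
  approx (suc i) = F₁ B (approx i) ∘ η lam (Seq A i)

  solution-levels : (β : F₀ G (Aω A) → Aω B) → IsSolution A B G lam ζA ζB β →
                    ∀ i y → proj B i (β y) ≡ approx i (F₁ G (proj A i) y)
  solution-levels β sol zero    y = refl
  solution-levels β sol (suc i) y = begin
    proj B (suc i) (β y)                               ≡⟨ cong (proj B (suc i)) (proj₂ invB (β y)) ⟨
    F₁ B (proj B i) (ζB (β y))                         ≡⟨ cong (F₁ B (proj B i)) (sol y) ⟩
    F₁ B (proj B i) (F₁ B β z)                         ≡⟨ F-∘ B (proj B i) β z ⟨
    F₁ B (proj B i ∘ β) z                              ≡⟨ F-cong B (solution-levels β sol i) z ⟩
    F₁ B (approx i ∘ F₁ G (proj A i)) z                ≡⟨ F-∘ B (approx i) (F₁ G (proj A i)) z ⟩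
    F₁ B (approx i) (F₁ B (F₁ G (proj A i)) z)
                                   ≡⟨ cong (F₁ B (approx i)) (nat lam (proj A i) (F₁ G ζA y)) ⟨
    F₁ B (approx i) (η lam _ (F₁ G (F₁ A (proj A i)) (F₁ G ζA y)))
                                   ≡⟨ cong (F₁ B (approx i) ∘ η lam _) (F-∘ G _ ζA y) ⟨
    F₁ B (approx i) (η lam _ (F₁ G (F₁ A (proj A i) ∘ ζA) y))
                                   ≡⟨ cong (F₁ B (approx i) ∘ η lam _) (F-cong G unfold-ζA y) ⟩
    approx (suc i) (F₁ G (proj A (suc i)) y)           ∎
    where
    open ≡-Reasoning
    z = η lam (Aω A) (F₁ G ζA y)
    unfold-ζA : F₁ A (proj A i) ∘ ζA ≗ proj A (suc i)
    unfold-ζA a = cong (proj A (suc i)) (proj₂ invA a)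

  solution-unique : Extensionality 0ℓ 0ℓ → (β₁ β₂ : F₀ G (Aω A) → Aω B) →
                    IsSolution A B G lam ζA ζB β₁ → IsSolution A B G lam ζA ζB β₂ → β₁ ≗ β₂
  solution-unique ext β₁ β₂ sol₁ sol₂ y = Lim-≡ ext {finalChain B} λ i →
    trans (solution-levels β₁ sol₁ i y) (sym (solution-levels β₂ sol₂ i y))

factorisation⇒causal : (A B F : Functor)
  (ζA : Aω A → F₀ A (Aω A)) → IsInverseOfStep A ζA →
  (ζB : Aω B → F₀ B (Aω B)) → IsInverseOfStep B ζB →
  (α : F₀ F (Aω A) → Aω B) → Factorisation A B F ζA ζB α → Causal A B F α
factorisation⇒causal A B F ζA invA ζB invB α (G , lam , κ , β , sol , _ , α≗) X f g i f≈g x = begin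
  proj B i (α (F₁ F f x))                  ≡⟨ through f ⟩
  approx i (F₁ G (proj A i) (F₁ G f k))    ≡⟨ cong (approx i) (F-∘ G (proj A i) f k) ⟨
  approx i (F₁ G (proj A i ∘ f) k)         ≡⟨ cong (approx i) (F-cong G f≈g k) ⟩
  approx i (F₁ G (proj A i ∘ g) k)         ≡⟨ cong (approx i) (F-∘ G (proj A i) g k) ⟩
  approx i (F₁ G (proj A i) (F₁ G g k))    ≡⟨ through g ⟨
  proj B i (α (F₁ F g x))                  ∎
  where
  open ≡-Reasoning
  open Solutions A B G lam ζA invA ζB invB
  k = η κ X x
  through : (h : X → Aω A) → proj B i (α (F₁ F h x)) ≡ approx i (F₁ G (proj A i) (F₁ G h k))
  through h = trans (cong (proj B i) (trans (α≗ (F₁ F h x)) (cong β (nat κ h x))))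
                    (solution-levels β sol i (F₁ G h k))

module Trees (ext : Extensionality 0ℓ 0ℓ) (B : Functor) (pol : IsPolynomial B)
  (ζB : Aω B → F₀ B (Aω B)) (invB : IsInverseOfStep B ζB) where
  open Polynomial B pol

  shape : Aω B → I
  shape t = proj₁ (φ (Aω B) (ζB t))

  child : (t : Aω B) → E (shape t) → Aω B
  child t = proj₂ (φ (Aω B) (ζB t))

  record _≈[_]_ (t : Aω B) (n : ℕ) (t' : Aω B) : Set where
    constructor ⟨_⟩
    field levels : proj B n t ≡ proj B n t'

  ≈-reindex : {t t' : Aω B} {j j' : ℕ} → j ≡ j' → t ≈[ j ] t' → t ≈[ j' ] t'
  ≈-reindex refl h = h

  ≈-children : {n : ℕ} {t t' : Aω B} → t ≈[ suc n ] t' →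
    Σ (shape t ≡ shape t') (λ q → ∀ x → child t x ≈[ n ] child t' (subst E q x))
  ≈-children {n} {t} {t'} ⟨ h ⟩ = proj₁ split , λ x → ⟨ proj₂ split x ⟩
    where
    open ≡-Reasoning
    level-suc : ∀ u → proj B (suc n) u ≡ F₁ B (proj B n) (ζB u)
    level-suc u = cong (proj B (suc n)) (sym (proj₂ invB u))
    roots : _≡_ {A = Ext (Seq B n)} (shape t , proj B n ∘ child t) (shape t' , proj B n ∘ child t')
    roots = begin
      (shape t , proj B n ∘ child t)          ≡⟨ φ-nat (proj B n) (ζB t) ⟨
      φ _ (F₁ B (proj B n) (ζB t))
        ≡⟨ cong (φ _) (trans (sym (level-suc t)) (trans h (level-suc t'))) ⟩
      φ _ (F₁ B (proj B n) (ζB t'))           ≡⟨ φ-nat (proj B n) (ζB t') ⟩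
      (shape t' , proj B n ∘ child t')        ∎
    split : Σ (shape t ≡ shape t')
              (λ q → ∀ x → proj B n (child t x) ≡ proj B n (child t' (subst E q x)))
    split = Σ-split E roots

  Path : ℕ → Aω B → Set
  Path zero    t = ⊤
  Path (suc n) t = Σ (E (shape t)) (λ e → Path n (child t e))

  subtree : (n : ℕ) (t : Aω B) → Path n t → Aω B
  subtree zero    t _       = t
  subtree (suc n) t (e , p) = subtree n (child t e) p

  extend : (n : ℕ) (t : Aω B) (p : Path n t) → E (shape (subtree n t p)) → Path (suc n) t
  extend zero    t p       x = x , tt
  extend (suc n) t (e , p) x = e , extend n (child t e) p x

  transport : (n k : ℕ) {t t' : Aω B} → t ≈[ n + k ] t' → Path n t → Path n t'
  transport zero    k h p       = tt
  transport (suc n) k h (e , p) =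
    subst E (proj₁ (≈-children h)) e , transport n k (proj₂ (≈-children h) e) p

  transport₀ : (n : ℕ) {t t' : Aω B} → t ≈[ n ] t' → Path n t → Path n t'
  transport₀ n h = transport n 0 (≈-reindex (sym (+-identityʳ n)) h)

  subtree-transport : (n k : ℕ) {t t' : Aω B} (h : t ≈[ n + k ] t') (p : Path n t) →
    subtree n t' (transport n k h p) ≈[ k ] subtree n t p
  subtree-transport zero    k h p       = ⟨ sym (_≈[_]_.levels h) ⟩
  subtree-transport (suc n) k h (e , p) = subtree-transport n k (proj₂ (≈-children h) e) p

  child-subst : {t u : Aω B} → t ≡ u → {a : I} (x : E a) (r₁ : a ≡ shape t) (r₂ : a ≡ shape u) →
    child t (subst E r₁ x) ≡ child u (subst E r₂ x)
  child-subst refl x refl refl = refl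

  child-subst₂ : {t u : Aω B} → t ≡ u → {a b : I} (x : E a) (r₁ : a ≡ b) (r₂ : b ≡ shape t)
    (r₃ : a ≡ shape u) → child t (subst E r₂ (subst E r₁ x)) ≡ child u (subst E r₃ x)
  child-subst₂ refl x refl refl refl = refl

  transport-trans : (n : ℕ) {t₁ t₂ t₃ t₃' : Aω B} → t₃ ≡ t₃' → (k₁₂ k₂₃ k₁₃ : ℕ)
    (h₁₂ : t₁ ≈[ n + k₁₂ ] t₂) (h₂₃ : t₂ ≈[ n + k₂₃ ] t₃) (h₁₃ : t₁ ≈[ n + k₁₃ ] t₃')
    (p : Path n t₁) →
    subtree n t₃ (transport n k₂₃ h₂₃ (transport n k₁₂ h₁₂ p)) ≡ subtree n t₃' (transport n k₁₃ h₁₃ p)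
  transport-trans zero    eq k₁₂ k₂₃ k₁₃ h₁₂ h₂₃ h₁₃ p       = eq
  transport-trans (suc n) eq k₁₂ k₂₃ k₁₃ h₁₂ h₂₃ h₁₃ (e , p) =
    transport-trans n
      (child-subst₂ eq e (proj₁ (≈-children h₁₂)) (proj₁ (≈-children h₂₃)) (proj₁ (≈-children h₁₃)))
      k₁₂ k₂₃ k₁₃ (proj₂ (≈-children h₁₂) e)
      (proj₂ (≈-children h₂₃) (subst E (proj₁ (≈-children h₁₂)) e)) (proj₂ (≈-children h₁₃) e) p

  transport-extend : (n : ℕ) {t u u₀ : Aω B} → u ≡ u₀ → (k : ℕ) (h : t ≈[ suc n + k ] u)
    (k₀ : ℕ) (h₀ : t ≈[ n + k₀ ] u₀) (p : Path n t) (x : E (shape (subtree n t p)))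
    (q : shape (subtree n t p) ≡ shape (subtree n u₀ (transport n k₀ h₀ p))) →
    subtree (suc n) u (transport (suc n) k h (extend n t p x))
      ≡ child (subtree n u₀ (transport n k₀ h₀ p)) (subst E q x)
  transport-extend zero    eq k h k₀ h₀ p       x q = child-subst eq x (proj₁ (≈-children h)) q
  transport-extend (suc n) eq k h k₀ h₀ (e , p) x q =
    transport-extend n (child-subst eq e (proj₁ (≈-children h)) (proj₁ (≈-children h₀)))
      k (proj₂ (≈-children h) e) k₀ (proj₂ (≈-children h₀) e) p x q

  subtree-unfolding : (n : ℕ) {t₀ t₁ t₂ t₂' : Aω B} (eq : t₂ ≡ t₂') (h₀₁ : t₀ ≈[ n ] t₁)
    (h₀₂ : t₀ ≈[ n ] t₂) (h₁₂ : t₁ ≈[ suc n ] t₂') (p : Path n t₀) →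
    _≡_ {A = Ext (Aω B)}
      (shape (subtree n t₂ (transport₀ n h₀₂ p)) , child (subtree n t₂ (transport₀ n h₀₂ p)))
      (shape (subtree n t₁ (transport₀ n h₀₁ p)) ,
        λ x → subtree (suc n) t₂' (transport₀ (suc n) h₁₂ (extend n t₁ (transport₀ n h₀₁ p) x)))
  subtree-unfolding n {t₀} {t₁} {t₂} refl h₀₁ h₀₂ h₁₂ p = Σ-ext E ext same-shape same-children
    where
    q = transport₀ n h₀₁ p
    h₁₂' : t₁ ≈[ n + 1 ] t₂
    h₁₂' = ≈-reindex (sym (+-comm n 1)) h₁₂
    via-t₁ : subtree n t₂ (transport₀ n h₀₂ p) ≡ subtree n t₂ (transport n 1 h₁₂' q)
    via-t₁ = sym (transport-trans n refl 0 1 0 _ h₁₂' _ p)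
    root : shape (subtree n t₂ (transport n 1 h₁₂' q)) ≡ shape (subtree n t₁ q)
    root = proj₁ (≈-children {0} (subtree-transport n 1 h₁₂' q))
    same-shape : shape (subtree n t₂ (transport₀ n h₀₂ p)) ≡ shape (subtree n t₁ q)
    same-shape = trans (cong shape via-t₁) root
    same-children : ∀ x → child (subtree n t₂ (transport₀ n h₀₂ p)) x ≡
      subtree (suc n) t₂ (transport₀ (suc n) h₁₂ (extend n t₁ q (subst E same-shape x)))
    same-children x =
      trans (sym (child-subst₂ (sym via-t₁) x same-shape (sym root) refl))
      (sym (transport-extend n refl 0 _ 1 h₁₂' q (subst E same-shape x) (sym root)))

module Iterates (A : Functor) where

  Iter : ℕ → Set → Set
  Iter zero    X = X
  Iter (suc n) X = F₀ A (Iter n X)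

  iter : (n : ℕ) {X Y : Set} → (X → Y) → Iter n X → Iter n Y
  iter zero    f = f
  iter (suc n) f = F₁ A (iter n f)

  iter-id : (n : ℕ) {X : Set} → iter n (id {A = X}) ≗ id
  iter-id zero    x = refl
  iter-id (suc n) x = trans (F-cong A (iter-id n) x) (F-id A x)

  iter-∘ : (n : ℕ) {X Y Z : Set} (g : Y → Z) (f : X → Y) → iter n (g ∘ f) ≗ iter n g ∘ iter n f
  iter-∘ zero    g f x = refl
  iter-∘ (suc n) g f x = trans (F-cong A (iter-∘ n g f) x) (F-∘ A (iter n g) (iter n f) x)

  iter-cong : (n : ℕ) {X Y : Set} {f g : X → Y} → f ≗ g → iter n f ≗ iter n g
  iter-cong zero    h = h
  iter-cong (suc n) h = F-cong A (iter-cong n h)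

  collapse : (n : ℕ) {X : Set} → Iter n X → Seq A n
  collapse zero    _ = tt
  collapse (suc n) = F₁ A (collapse n)

  collapse-iter : (n : ℕ) {X Y : Set} (f : X → Y) → collapse n ∘ iter n f ≗ collapse n
  collapse-iter zero    f x = refl
  collapse-iter (suc n) f x =
    trans (sym (F-∘ A (collapse n) (iter n f) x)) (F-cong A (collapse-iter n f) x)

  reassoc : (n : ℕ) {X : Set} → Iter n (F₀ A X) → Iter (suc n) X
  reassoc zero    x = x
  reassoc (suc n) = F₁ A (reassoc n)

  reassoc-nat : (n : ℕ) {X Y : Set} (f : X → Y) →
                reassoc n ∘ iter n (F₁ A f) ≗ iter (suc n) f ∘ reassoc n
  reassoc-nat zero    f x = refl
  reassoc-nat (suc n) f x =
    trans (sym (F-∘ A (reassoc n) (iter n (F₁ A f)) x))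
      (trans (F-cong A (reassoc-nat n f) x) (F-∘ A (iter (suc n) f) (reassoc n) x))

  conn-collapse : (n : ℕ) {X : Set} → conn A n ∘ collapse (suc n) ∘ reassoc n {X} ≗ collapse n
  conn-collapse zero    x = refl
  conn-collapse (suc n) x =
    trans (sym (F-∘ A (conn A n) (collapse (suc n)) (F₁ A (reassoc n) x)))
      (trans (sym (F-∘ A (conn A n ∘ collapse (suc n)) (reassoc n) x)) (F-cong A (conn-collapse n) x))

  module Unfolding (ζA : Aω A → F₀ A (Aω A)) (invA : IsInverseOfStep A ζA) where

    unfold : (n : ℕ) → Iter n (Aω A) → Aω A
    unfold zero    x = x
    unfold (suc n) x = step A (F₁ A (unfold n) x)

    collapse-unfold : (n : ℕ) → collapse n ≗ proj A n ∘ unfold n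
    collapse-unfold zero    x = refl
    collapse-unfold (suc n) x = trans (F-cong A (collapse-unfold n) x) (F-∘ A (proj A n) (unfold n) x)

    unfold-ζA : (n : ℕ) → unfold (suc n) ∘ reassoc n ∘ iter n ζA ≗ unfold n
    unfold-ζA zero    x = trans (cong (step A) (F-id A (ζA x))) (proj₂ invA x)
    unfold-ζA (suc n) x = cong (step A)
      (trans (sym (F-∘ A (unfold (suc n)) (reassoc n) (F₁ A (iter n ζA) x)))
        (trans (sym (F-∘ A (unfold (suc n) ∘ reassoc n) (iter n ζA) x)) (F-cong A (unfold-ζA n) x)))

-- Every stage A_{k+1} embeds into A_ω: the missing levels are filled in
-- using the element of A_1 underlying the given point.
module Sections (A : Functor) where

  toLevel₁ : (k : ℕ) → Seq A (suc k) → Seq A 1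
  toLevel₁ zero    x = x
  toLevel₁ (suc k) x = toLevel₁ k (conn A (suc k) x)

  module Padding (a : Seq A 1) where

    filler : (n : ℕ) → Seq A n
    filler zero    = tt
    filler (suc n) = F₁ A (λ _ → filler n) a

    resize : (j n : ℕ) → Seq A j → Seq A n
    resize j       zero    x = tt
    resize zero    (suc n) x = filler (suc n)
    resize (suc j) (suc n) x = F₁ A (resize j n) x

    filler-coh : (n : ℕ) → conn A n (filler (suc n)) ≡ filler n
    filler-coh zero    = refl
    filler-coh (suc n) = trans (sym (F-∘ A (conn A n) (λ _ → filler (suc n)) a))
                               (F-cong A (λ _ → filler-coh n) a)

    resize-coh : (j n : ℕ) (x : Seq A j) → conn A n (resize j (suc n) x) ≡ resize j n x
    resize-coh j       zero    x = refl
    resize-coh zero    (suc n) x = filler-coh (suc n)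
    resize-coh (suc j) (suc n) x =
      trans (sym (F-∘ A (conn A n) (resize j (suc n)) x)) (F-cong A (resize-coh j n) x)

    resize-id : (j : ℕ) → resize j j ≗ id
    resize-id zero    x = refl
    resize-id (suc j) x = trans (F-cong A (resize-id j) x) (F-id A x)

  open Padding

  section : (k : ℕ) → Seq A (suc k) → Aω A
  section k x = (λ n → resize (toLevel₁ k x) (suc k) n x) , (λ n → resize-coh (toLevel₁ k x) (suc k) n x)

  proj-section : (k : ℕ) → proj A (suc k) ∘ section k ≗ id
  proj-section k x = resize-id (toLevel₁ k x) (suc k) x

module Construction (ext : Extensionality 0ℓ 0ℓ) (A B F : Functor) (pol : IsPolynomial B)
  (ζA : Aω A → F₀ A (Aω A)) (invA : IsInverseOfStep A ζA)
  (ζB : Aω B → F₀ B (Aω B)) (invB : IsInverseOfStep B ζB)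
  (α : F₀ F (Aω A) → Aω B) (causal : Causal A B F α) where
  open Polynomial B pol
  open Trees ext B pol ζB invB
  open Iterates A
  open Unfolding ζA invA
  open Sections A

  -- The output of α on some input extending c ∈ F A_{m+1}; by causality its
  -- first m+1 levels do not depend on the extension chosen.
  tree : (m : ℕ) → F₀ F (Seq A (suc m)) → Aω B
  tree m c = α (F₁ F (section m) c)

  tree≈unfold : (m : ℕ) (c : F₀ F (Seq A (suc m))) (w : F₀ F (Iter (suc m) (Aω A))) →
    F₁ F (collapse (suc m)) w ≡ c → tree m c ≈[ suc m ] α (F₁ F (unfold (suc m)) w)
  tree≈unfold m c w refl =
    ⟨ trans (cong (proj B (suc m) ∘ α) (sym (F-∘ F (section m) (collapse (suc m)) w)))
            (causal _ (section m ∘ collapse (suc m)) (unfold (suc m)) (suc m) same-level w) ⟩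
    where
    same-level : proj A (suc m) ∘ section m ∘ collapse (suc m) ≗ proj A (suc m) ∘ unfold (suc m)
    same-level x = trans (proj-section m (collapse (suc m) x)) (collapse-unfold (suc m) x)

  tree≈refine : (m : ℕ) (c : F₀ F (Seq A (suc m))) (c' : F₀ F (Seq A (suc (suc m)))) →
    c ≡ F₁ F (conn A (suc m)) c' → tree m c ≈[ suc m ] tree (suc m) c'
  tree≈refine m c c' refl =
    ⟨ trans (cong (proj B (suc m) ∘ α) (sym (F-∘ F (section m) (conn A (suc m)) c')))
            (causal _ (section m ∘ conn A (suc m)) (section (suc m)) (suc m) same-level c') ⟩
    where
    same-level : proj A (suc m) ∘ section m ∘ conn A (suc m) ≗ proj A (suc m) ∘ section (suc m)
    same-level x = trans (proj-section m (conn A (suc m) x))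
      (trans (cong (conn A (suc m)) (sym (proj-section (suc m) x))) (proj₂ (section (suc m) x) (suc m)))

  -- A position below the root: a depth m, the input c ∈ F A_{m+1} read so far,
  -- a path of length m+1 in its tree, and an input w ∈ F (A^{m+1} X) lying over c.
  record Position (X : Set) : Set where
    constructor pos
    field
      m : ℕ
      c : F₀ F (Seq A (suc m))
      p : Path (suc m) (tree m c)
      w : F₀ F (Iter (suc m) X)
      e : F₁ F (collapse (suc m)) w ≡ c

  G₀ : Set → Set
  G₀ X = F₀ F X ⊎ Position X

  G₁ : {X Y : Set} → (X → Y) → G₀ X → G₀ Y
  G₁ f (inj₁ w)             = inj₁ (F₁ F f w)
  G₁ f (inj₂ (pos m c p w e)) = inj₂ (pos m c p (F₁ F (iter (suc m) f) w)
    (trans (sym (F-∘ F (collapse (suc m)) (iter (suc m) f) w))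
           (trans (F-cong F (collapse-iter (suc m) f) w) e)))

  pos-≡ : {X : Set} {m : ℕ} {c : F₀ F (Seq A (suc m))} {p : Path (suc m) (tree m c)}
    {w w' : F₀ F (Iter (suc m) X)} {e : F₁ F (collapse (suc m)) w ≡ c}
    {e' : F₁ F (collapse (suc m)) w' ≡ c} → w ≡ w' → pos m c p w e ≡ pos m c p w' e'
  pos-≡ {e = e} {e'} refl = cong (pos _ _ _ _) (uip e e')

  G : Functor
  G = record
    { F₀ = G₀
    ; F₁ = G₁
    ; F-id = λ { (inj₁ w) → cong inj₁ (F-id F w)
               ; (inj₂ (pos m c p w e)) →
                   cong inj₂ (pos-≡ (trans (F-cong F (iter-id (suc m)) w) (F-id F w))) }
    ; F-∘ = λ g f → λ
               { (inj₁ w) → cong inj₁ (F-∘ F g f w)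
               ; (inj₂ (pos m c p w e)) → cong inj₂ (pos-≡ (trans (F-cong F (iter-∘ (suc m) g f) w)
                                             (F-∘ F (iter (suc m) g) (iter (suc m) f) w))) }
    ; F-cong = λ h → λ
               { (inj₁ w) → cong inj₁ (F-cong F h w)
               ; (inj₂ (pos m c p w e)) → cong inj₂ (pos-≡ (F-cong F (iter-cong (suc m) h) w)) }
    }

  κ : NatTrans F G
  κ = record { η = λ X w → inj₁ w ; nat = λ f x → refl }

  next₀ : {X : Set} (c' : F₀ F (Seq A 1)) (w' : F₀ F (Iter 1 X)) →
    F₁ F (collapse 1) w' ≡ c' → Ext (G₀ X)
  next₀ c' w' e' = shape (tree 0 c') , λ x → inj₂ (pos 0 c' (x , tt) w' e')

  next : {X : Set} (m : ℕ) (c : F₀ F (Seq A (suc m))) (p : Path (suc m) (tree m c))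
    (c' : F₀ F (Seq A (suc (suc m)))) (hc : c ≡ F₁ F (conn A (suc m)) c')
    (w' : F₀ F (Iter (suc (suc m)) X)) → F₁ F (collapse (suc (suc m))) w' ≡ c' → Ext (G₀ X)
  next m c p c' hc w' e' =
    shape (subtree (suc m) (tree (suc m) c') p') ,
    λ x → inj₂ (pos (suc m) c' (extend (suc m) (tree (suc m) c') p' x) w' e')
    where p' = transport₀ (suc m) (tree≈refine m c c' hc) p

  next₀-cong : {X : Set} {c₁ c₂ : F₀ F (Seq A 1)} {w₁ w₂ : F₀ F (Iter 1 X)}
    (e₁ : F₁ F (collapse 1) w₁ ≡ c₁) (e₂ : F₁ F (collapse 1) w₂ ≡ c₂) →
    c₁ ≡ c₂ → w₁ ≡ w₂ → next₀ c₁ w₁ e₁ ≡ next₀ c₂ w₂ e₂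
  next₀-cong e₁ e₂ refl refl with uip e₁ e₂
  ... | refl = refl

  next-cong : {X : Set} (m : ℕ) (c : F₀ F (Seq A (suc m))) (p : Path (suc m) (tree m c))
    {c₁ c₂ : F₀ F (Seq A (suc (suc m)))}
    (hc₁ : c ≡ F₁ F (conn A (suc m)) c₁) (hc₂ : c ≡ F₁ F (conn A (suc m)) c₂)
    {w₁ w₂ : F₀ F (Iter (suc (suc m)) X)}
    (e₁ : F₁ F (collapse (suc (suc m))) w₁ ≡ c₁) (e₂ : F₁ F (collapse (suc (suc m))) w₂ ≡ c₂) →
    c₁ ≡ c₂ → w₁ ≡ w₂ → next m c p c₁ hc₁ w₁ e₁ ≡ next m c p c₂ hc₂ w₂ e₂
  next-cong m c p hc₁ hc₂ e₁ e₂ refl refl with uip e₁ e₂ | uip hc₁ hc₂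
  ... | refl | refl = refl

  refines : {X : Set} (m : ℕ) (c : F₀ F (Seq A (suc m))) (w : F₀ F (Iter (suc m) (F₀ A X))) →
    F₁ F (collapse (suc m)) w ≡ c →
    c ≡ F₁ F (conn A (suc m)) (F₁ F (collapse (suc (suc m))) (F₁ F (reassoc (suc m)) w))
  refines m c w refl = sym (begin
    F₁ F (conn A (suc m)) (F₁ F (collapse (suc (suc m))) (F₁ F (reassoc (suc m)) w))
      ≡⟨ F-∘ F (conn A (suc m)) (collapse (suc (suc m))) _ ⟨
    F₁ F (conn A (suc m) ∘ collapse (suc (suc m))) (F₁ F (reassoc (suc m)) w)
      ≡⟨ F-∘ F (conn A (suc m) ∘ collapse (suc (suc m))) (reassoc (suc m)) w ⟨
    F₁ F (conn A (suc m) ∘ collapse (suc (suc m)) ∘ reassoc (suc m)) w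
      ≡⟨ F-cong F (conn-collapse (suc m)) w ⟩
    F₁ F (collapse (suc m)) w ∎)
    where open ≡-Reasoning

  λ-ext : (X : Set) → G₀ (F₀ A X) → Ext (G₀ X)
  λ-ext X (inj₁ w) = next₀ (F₁ F (collapse 1) w) w refl
  λ-ext X (inj₂ (pos m c p w e)) =
    next m c p (F₁ F (collapse (suc (suc m))) w') (refines m c w e) w' refl
    where w' = F₁ F (reassoc (suc m)) w

  -- naturality: reindexing the input does not change the refined inputs c'
  λ-nat : {X Y : Set} (f : X → Y) (s : G₀ (F₀ A X)) →
          λ-ext Y (G₁ (F₁ A f) s) ≡ (proj₁ (λ-ext X s) , G₁ f ∘ proj₂ (λ-ext X s))
  λ-nat f (inj₁ w) =
    next₀-cong _ _ (trans (sym (F-∘ F (collapse 1) (F₁ A f) w)) (F-cong F (collapse-iter 1 f) w)) refl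
  λ-nat f (inj₂ (pos m c p w e)) = next-cong m c p _ _ _ _ same-prefix same-input
    where
    w' = F₁ F (reassoc (suc m)) w
    same-input : F₁ F (reassoc (suc m)) (F₁ F (iter (suc m) (F₁ A f)) w) ≡ F₁ F (iter (suc (suc m)) f) w'
    same-input = trans (sym (F-∘ F (reassoc (suc m)) (iter (suc m) (F₁ A f)) w))
      (trans (F-cong F (reassoc-nat (suc m) f) w) (F-∘ F (iter (suc (suc m)) f) (reassoc (suc m)) w))
    same-prefix : F₁ F (collapse (suc (suc m))) (F₁ F (reassoc (suc m)) (F₁ F (iter (suc m) (F₁ A f)) w))
                  ≡ F₁ F (collapse (suc (suc m))) w'
    same-prefix = trans (cong (F₁ F (collapse (suc (suc m)))) same-input)
      (trans (sym (F-∘ F (collapse (suc (suc m))) (iter (suc (suc m)) f) w'))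
             (F-cong F (collapse-iter (suc (suc m)) f) w'))

  lam : NatTrans (G ⊙ A) (B ⊙ G)
  lam = record { η = λ X → φ⁻¹ (G₀ X) ∘ λ-ext X
               ; nat = λ f s → φ⁻¹-nat (G₁ f) (λ-ext _ s) _ (λ-nat f s) }

  β : G₀ (Aω A) → Aω B
  β (inj₁ w) = α w
  β (inj₂ (pos m c p w e)) =
    subtree (suc m) (α (F₁ F (unfold (suc m)) w)) (transport₀ (suc m) (tree≈unfold m c w e) p)

  β-solution : IsSolution A B G lam ζA ζB β
  β-solution (inj₁ w) = ≡F₁φ⁻¹ β _ _
    (subtree-unfolding 0 {α w} same-input ⟨ refl ⟩ ⟨ refl ⟩ (tree≈unfold 0 c' w₁ refl) tt)
    where
    w₁ = F₁ F ζA w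
    c' = F₁ F (collapse 1) w₁
    same-input : α w ≡ α (F₁ F (unfold 1) w₁)
    same-input = cong α (sym (trans (sym (F-∘ F (unfold 1) ζA w))
                                   (trans (F-cong F (unfold-ζA 0) w) (F-id F w))))
  β-solution (inj₂ (pos m c p w e)) = ≡F₁φ⁻¹ β _ _
    (subtree-unfolding (suc m) same-input (tree≈refine m c c' (refines m c w₁ e₁))
       (tree≈unfold m c w e) (tree≈unfold (suc m) c' w' refl) p)
    where
    w₁ = F₁ F (iter (suc m) ζA) w
    e₁ : F₁ F (collapse (suc m)) w₁ ≡ c
    e₁ = trans (sym (F-∘ F (collapse (suc m)) (iter (suc m) ζA) w))
               (trans (F-cong F (collapse-iter (suc m) ζA) w) e)
    w' = F₁ F (reassoc (suc m)) w₁
    c' = F₁ F (collapse (suc (suc m))) w'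
    same-input : α (F₁ F (unfold (suc m)) w) ≡ α (F₁ F (unfold (suc (suc m))) w')
    same-input = cong α (sym (trans (sym (F-∘ F (unfold (suc (suc m))) (reassoc (suc m)) w₁))
      (trans (sym (F-∘ F (unfold (suc (suc m)) ∘ reassoc (suc m)) (iter (suc m) ζA) w))
             (F-cong F (unfold-ζA (suc m)) w))))

causal⇒factorisation : Extensionality 0ℓ 0ℓ → (A B F : Functor) → IsPolynomial B →
  (ζA : Aω A → F₀ A (Aω A)) → IsInverseOfStep A ζA →
  (ζB : Aω B → F₀ B (Aω B)) → IsInverseOfStep B ζB →
  (α : F₀ F (Aω A) → Aω B) → Causal A B F α → Factorisation A B F ζA ζB α
causal⇒factorisation ext A B F pol ζA invA ζB invB α causal =
  G , lam , κ , β , β-solution , (λ β′ sol′ → solution-unique ext β′ β sol′ β-solution) , (λ _ → refl)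
  where
  open Construction ext A B F pol ζA invA ζB invB α causal
  open Solutions A B G lam ζA invA ζB invB using (solution-unique)

theorem9p5 : Extensionality 0ℓ 0ℓ →
    (A B F : Functor) → ωContinuous A → IsPolynomial B →
    (ζA : Aω A → F₀ A (Aω A)) → IsInverseOfStep A ζA →
    (ζB : Aω B → F₀ B (Aω B)) → IsInverseOfStep B ζB →
    (α : F₀ F (Aω A) → Aω B) →
    Causal A B F α ⇔
      Σ Functor (λ G →
      Σ (NatTrans (G ⊙ A) (B ⊙ G)) (λ lam →
      Σ (NatTrans F G) (λ κ →
      Σ (F₀ G (Aω A) → Aω B) (λ β →
        (ζB ∘ β ≗ F₁ B β ∘ η lam (Aω A) ∘ F₁ G ζA)
        × ((β′ : F₀ G (Aω A) → Aω B) →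
             ζB ∘ β′ ≗ F₁ B β′ ∘ η lam (Aω A) ∘ F₁ G ζA → β′ ≗ β)
        × (α ≗ β ∘ η κ (Aω A))))))
theorem9p5 ext A B F _ pol ζA invA ζB invB α =
  mk⇔ (causal⇒factorisation ext A B F pol ζA invA ζB invB α)
      (factorisation⇒causal A B F ζA invA ζB invB α)
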